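{- For each integer $t \ge 3$ and each positive integer $k$, there exists a graph $G$ on $k(t-1)+1$ vertices which is $\lfloor k/2\rfloor$-locally-$K_t$-minor-free but not $(t-1)$-colourable.
   Context: For a vertex $v$ of a graph $G$ and a nonnegative integer $c$, the ball $B_c[v]$ is the subgraph of $G$ induced by all vertices at distance at most $c$ from $v$. A graph $G$ is $c$-locally-$K_t$-minor-free if for every vertex $v\in V(G)$, $B_c[v]$ has no $K_t$ minor. -}

module Defs where

open import Data.Nat using (ℕ; zero; suc)
open import Data.Fin using (Fin)
open import Data.Bool using (Bool; true; false)
open import Data.Maybe using (Maybe; just)
open import Data.Product using (Σ; ∃; _×_; _,_)
open import Relation.Binary.PropositionalEquality using (_≡_; _≢_)
open import Relation.Nullary using (¬_)

record Graph (n : ℕ) : Set where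
  field
    adj     : Fin n → Fin n → Bool
    adj-sym : ∀ u v → adj u v ≡ adj v u
    loopless : ∀ v → adj v v ≡ false

open Graph public

Adj : ∀ {n} → Graph n → Fin n → Fin n → Set
Adj G u v = adj G u v ≡ true

data WithinDist {n : ℕ} (G : Graph n) : ℕ → Fin n → Fin n → Set where
  here : ∀ {c u} → WithinDist G c u u
  step : ∀ {c u x w} → Adj G u x → WithinDist G c x w → WithinDist G (suc c) u w

Ball : ∀ {n} → Graph n → ℕ → Fin n → Fin n → Set
Ball G c v u = WithinDist G c v u

data WalkIn {n : ℕ} (G : Graph n) (P : Fin n → Set) : Fin n → Fin n → Set where
  here : ∀ {x} → P x → WalkIn G P x x
  step : ∀ {x y z} → P x → Adj G x y → WalkIn G P y z → WalkIn G P x z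

-- A K_t minor model in the induced subgraph G[S]: a partial map β assigning
-- vertices to branch sets (β u ≡ just i means u ∈ B_i; so branch sets are
-- disjoint), with every branch set nonempty, contained in S, connected in G[S],
-- and any two distinct branch sets joined by an edge.
record KMinorModel {n : ℕ} (G : Graph n) (S : Fin n → Set) (t : ℕ) : Set where
  field
    β        : Fin n → Maybe (Fin t)
    inS      : ∀ u i → β u ≡ just i → S u
    nonempty : ∀ i → ∃ λ u → β u ≡ just i
    connected : ∀ i x y → β x ≡ just i → β y ≡ just i →
                WalkIn G (λ z → β z ≡ just i) x y
    adjacent : ∀ i j → i ≢ j →
               ∃ λ x → ∃ λ y → β x ≡ just i × β y ≡ just j × Adj G x y

HasKMinorIn : ∀ {n} → Graph n → (Fin n → Set) → ℕ → Set
HasKMinorIn G S t = KMinorModel G S t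

LocallyKMinorFree : ∀ {n} → Graph n → ℕ → ℕ → Set
LocallyKMinorFree G c t = ∀ v → ¬ HasKMinorIn G (Ball G c v) t

Colourable : ∀ {n} → Graph n → ℕ → Set
Colourable {n} G m = Σ (Fin n → Fin m) λ f → ∀ u v → Adj G u v → f u ≢ f v

{-# OPTIONS --safe #-}
-- G is a blow-up of the cycle C_{2k+1} (m = t - 1): a hub and k blocks, each an apex together
-- with m - 1 side vertices forming a K_m, arranged around the cycle as
-- hub, apex₀, sides₀, apex₁, sides₁, …, apex_{k-1}, sides_{k-1}.
-- In an m-colouring the sides of block i miss exactly one colour, which apex i and apex i+1 both
-- take; so all apexes and the hub share a colour, although the hub is adjacent to apex 0.
-- A ball of radius r < k meets at most 2r + 1 < 2k + 1 consecutive bags, so after rotating the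
-- cycle it is layered by bag position: edges join equal or consecutive levels, and any two
-- consecutive levels hold at most m vertices. Such a graph has no K_{m+1} minor: at the least Q
-- such that every branch set has a vertex of level ≤ Q, some branch set lies at levels ≥ Q, and
-- every branch set (being connected and adjacent to it) has a vertex of level Q - 1 or Q, which
-- gives m + 1 distinct vertices in two consecutive levels.
module Submission where

open import Defs
open import Data.Nat using (ℕ; NonZero; zero; suc; pred; _+_; _*_; _∸_; _/_; _≤_; _<_; z≤n; s≤s; _≤?_; _≟_)
open import Data.Nat.Properties
open import Data.Nat.DivMod using (_%_; %-distribˡ-+; m%n%n≡m%n; m<n⇒m%n≡m; m%n<n; m%n≤n; n%n≡0; [m+n]%n≡m%n; m/n<m)
open import Data.Fin using (Fin; toℕ; inject₁; fromℕ)
import Data.Fin as F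
import Data.Fin.Properties as FP
open import Data.Fin.Induction using (<-weakInduction)
open import Data.Vec.Functional using (_∷_)
open import Data.Maybe using (just)
import Data.Maybe.Properties as MP
open import Data.Product using (Σ; ∃; _×_; _,_; proj₁; proj₂)
open import Data.Sum using (_⊎_; inj₁; inj₂)
open import Data.Sum.Function.Propositional using (_⊎-↔_)
open import Data.Unit using (⊤; tt)
open import Data.Empty using (⊥; ⊥-elim)
open import Function using (_∘_; Injective; _↔_; Inverse; mk⇔)
open import Function.Construct.Composition using (_↔-∘_)
open import Relation.Binary.PropositionalEquality
open import Relation.Nullary using (¬_; Dec; yes; no; does)
open import Relation.Nullary.Decidable using (_×-dec_; _⊎-dec_; ¬?; dec-true; dec-false; does-⇔)
open ≡-Reasoning

bounded : ∀ {n} (f : Fin n → ℕ) → ∃ λ B → ∀ u → f u ≤ B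
bounded {zero} f = 0 , λ ()
bounded {suc n} f with bounded (f ∘ F.suc)
... | B , f≤B = f F.zero + B , λ { F.zero → m≤m+n _ B ; (F.suc u) → ≤-trans (f≤B u) (m≤n+m B _) }

module Layering {n : ℕ} (G : Graph n) (S : Fin n → Set) (level : Fin n → ℕ)
  (level-step : ∀ u w → S u → S w → Adj G u w → level w ≤ suc (level u)) where

  InWindow : ℕ → Fin n → Set
  InWindow Q u = level u ≤ Q × Q ≤ suc (level u)

  walk-start : ∀ {P x y} → WalkIn G P x y → P x
  walk-start (here px) = px
  walk-start (step px _ _) = px

  walk-meets-window : ∀ {P x y} Q → (∀ z → P z → S z) → WalkIn G P x y →
                      level x ≤ Q → Q ≤ suc (level y) → ∃ λ z → P z × InWindow Q z
  walk-meets-window Q P⊆S (here px) x≤Q Q≤y = _ , px , x≤Q , Q≤y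
  walk-meets-window {x = x} Q P⊆S (step {y = x'} px x~x' rest) x≤Q Q≤y with Q ≤? suc (level x)
  ... | yes Q≤x = x , px , x≤Q , Q≤x
  ... | no Q≰x = walk-meets-window Q P⊆S rest x'≤Q Q≤y
    where
    x'≤Q : level x' ≤ Q
    x'≤Q = ≤-trans (level-step x x' (P⊆S x px) (P⊆S x' (walk-start rest)) x~x') (<⇒≤ (≰⇒> Q≰x))

  NarrowWindows : ℕ → Set
  NarrowWindows p = ∀ Q → Σ (Fin n → Fin p) λ slot →
    ∀ u w → S u → S w → InWindow Q u → InWindow Q w → slot u ≡ slot w → u ≡ w

  no-complete-minor : ∀ {p} → NarrowWindows p → ¬ KMinorModel G S (suc p)
  no-complete-minor {p} narrow M with B , level≤B ← bounded level =
    never-reaches B λ i → let u , u∈i = nonempty i in u , u∈i , level≤B u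
    where
    open KMinorModel M

    Reaches : ℕ → Fin (suc p) → Set
    Reaches Q i = ∃ λ u → β u ≡ just i × level u ≤ Q

    reaches? : ∀ Q i → Dec (Reaches Q i)
    reaches? Q i = FP.any? λ u → MP.≡-dec FP._≟_ (β u) (just i) ×-dec (level u ≤? Q)

    no-window-representatives : ∀ Q → (∀ i → ∃ λ u → β u ≡ just i × InWindow Q u) → ⊥
    no-window-representatives Q rep with narrow Q
    ... | slot , slot-injective
      with i , j , i<j , same ← FP.pigeonhole (n<1+n p) (λ i → slot (proj₁ (rep i)))
      with u , u∈i , u∈Q ← rep i | w , w∈j , w∈Q ← rep j =
      FP.<⇒≢ i<j (MP.just-injective (begin
        just i ≡⟨ sym u∈i ⟩
        β u    ≡⟨ cong β (slot-injective u w (inS u i u∈i) (inS w j w∈j) u∈Q w∈Q same) ⟩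
        β w    ≡⟨ w∈j ⟩
        just j ∎))

    never-reaches : ∀ Q → ¬ (∀ i → Reaches Q i)
    never-reaches zero reach =
      no-window-representatives 0 λ i → let u , u∈i , u≤0 = reach i in u , u∈i , u≤0 , z≤n
    never-reaches (suc Q) reach with FP.all? (reaches? Q)
    ... | yes reach' = never-reaches Q reach'
    ... | no ¬reach' with a , a-high ← FP.¬∀⟶∃¬ _ _ (reaches? Q) ¬reach' =
      no-window-representatives (suc Q) window-rep
      where
      above : ∀ y → β y ≡ just a → suc Q ≤ level y
      above y y∈a = ≰⇒> λ y≤Q → a-high (y , y∈a , y≤Q)

      window-rep : ∀ i → ∃ λ u → β u ≡ just i × InWindow (suc Q) u
      window-rep i with x , x∈i , x≤ ← reach i | i FP.≟ a
      ... | yes refl = x , x∈i , x≤ , m≤n⇒m≤1+n (above x x∈i)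
      ... | no i≢a with x' , y , x'∈i , y∈a , x'~y ← adjacent i a i≢a =
        walk-meets-window (suc Q) (λ z z∈i → inS z i z∈i) (connected i x x' x∈i x'∈i) x≤
          (≤-trans (above y y∈a) (level-step x' y (inS x' i x'∈i) (inS y a y∈a) x'~y))


[m%d+n]%d≡[m+n]%d : ∀ m n d .{{_ : NonZero d}} → (m % d + n) % d ≡ (m + n) % d
[m%d+n]%d≡[m+n]%d m n d = begin
  (m % d + n) % d         ≡⟨ %-distribˡ-+ (m % d) n d ⟩
  (m % d % d + n % d) % d ≡⟨ cong (λ x → (x + n % d) % d) (m%n%n≡m%n m d) ⟩
  (m % d + n % d) % d     ≡⟨ %-distribˡ-+ m n d ⟨
  (m + n) % d             ∎

[m+n%d]%d≡[m+n]%d : ∀ m n d .{{_ : NonZero d}} → (m + n % d) % d ≡ (m + n) % d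
[m+n%d]%d≡[m+n]%d m n d = begin
  (m + n % d) % d ≡⟨ cong (_% d) (+-comm m (n % d)) ⟩
  (n % d + m) % d ≡⟨ [m%d+n]%d≡[m+n]%d n m d ⟩
  (n + m) % d     ≡⟨ cong (_% d) (+-comm n m) ⟩
  (m + n) % d     ∎

window-values : ∀ {x Q} → x ≤ Q → Q ≤ suc x → x ≡ Q ⊎ suc x ≡ Q
window-values x≤Q Q≤1+x with m≤n⇒m<n∨m≡n x≤Q
... | inj₁ x<Q = inj₂ (≤-antisym x<Q Q≤1+x)
... | inj₂ x≡Q = inj₁ x≡Q

module Cycle (K : ℕ) where

  next : ℕ → ℕ
  next b = suc b % suc K

  Near : ℕ → ℕ → Set
  Near b b' = b ≡ b' ⊎ next b ≡ b' ⊎ next b' ≡ b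

  near? : ∀ b b' → Dec (Near b b')
  near? b b' = (b ≟ b') ⊎-dec (next b ≟ b') ⊎-dec (next b' ≟ b)

  near-sym : ∀ {b b'} → Near b b' → Near b' b
  near-sym (inj₁ b≡b') = inj₁ (sym b≡b')
  near-sym (inj₂ (inj₁ b→b')) = inj₂ (inj₂ b→b')
  near-sym (inj₂ (inj₂ b'→b)) = inj₂ (inj₁ b'→b)

  next-≤ : ∀ b → next b ≤ K
  next-≤ b = ≤-pred (m%n<n (suc b) (suc K))

  next-< : ∀ {b} → b < K → next b ≡ suc b
  next-< b<K = m<n⇒m%n≡m (s≤s b<K)

  next-last : next K ≡ 0
  next-last = n%n≡0 (suc K)

  next-cases : ∀ {b} → b ≤ K → (b < K × next b ≡ suc b) ⊎ (b ≡ K × next b ≡ 0)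
  next-cases {b} b≤K with m≤n⇒m<n∨m≡n b≤K
  ... | inj₁ b<K = inj₁ (b<K , next-< b<K)
  ... | inj₂ refl = inj₂ (refl , next-last)

  near-interior : ∀ {x y} → Near x y → 0 < x → x < K → y ≤ K → y ≤ suc x × x ≤ suc y
  near-interior (inj₁ refl) _ _ _ = n≤1+n _ , n≤1+n _
  near-interior (inj₂ (inj₁ x→y)) _ x<K _ rewrite next-< x<K with refl ← x→y = ≤-refl , m≤n⇒m≤1+n (n≤1+n _)
  near-interior (inj₂ (inj₂ y→x)) 0<x _ y≤K with next-cases y≤K
  ... | inj₁ (_ , next-y) with refl ← trans (sym next-y) y→x = m≤n⇒m≤1+n (n≤1+n _) , ≤-refl
  ... | inj₂ (_ , next-y) with refl ← trans (sym next-y) y→x with () ← 0<x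

  rotate : ℕ → ℕ → ℕ
  rotate s b = (b + s) % suc K

  rotate-≤ : ∀ s b → rotate s b ≤ K
  rotate-≤ s b = ≤-pred (m%n<n (b + s) (suc K))

  rotate-next : ∀ s b → rotate s (next b) ≡ next (rotate s b)
  rotate-next s b = begin
    (suc b % suc K + s) % suc K ≡⟨ [m%d+n]%d≡[m+n]%d (suc b) s (suc K) ⟩
    (1 + (b + s)) % suc K       ≡⟨ [m+n%d]%d≡[m+n]%d 1 (b + s) (suc K) ⟨
    (1 + rotate s b) % suc K    ∎

  rotate-near : ∀ s {b b'} → Near b b' → Near (rotate s b) (rotate s b')
  rotate-near s (inj₁ b≡b') = inj₁ (cong (rotate s) b≡b')
  rotate-near s {b} (inj₂ (inj₁ b→b')) =
    inj₂ (inj₁ (trans (sym (rotate-next s b)) (cong (rotate s) b→b')))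
  rotate-near s {b' = b'} (inj₂ (inj₂ b'→b)) =
    inj₂ (inj₂ (trans (sym (rotate-next s b')) (cong (rotate s) b'→b)))

  rotate-back : ∀ s {b} → b ≤ K → rotate (suc K ∸ s % suc K) (rotate s b) ≡ b
  rotate-back s {b} b≤K = begin
    ((b + s) % L + (L ∸ s % L)) % L       ≡⟨ cong (λ x → (x + (L ∸ s % L)) % L) ([m+n%d]%d≡[m+n]%d b s L) ⟨
    ((b + s % L) % L + (L ∸ s % L)) % L   ≡⟨ [m%d+n]%d≡[m+n]%d (b + s % L) (L ∸ s % L) L ⟩
    (b + s % L + (L ∸ s % L)) % L         ≡⟨ cong (_% L) (+-assoc b (s % L) (L ∸ s % L)) ⟩
    (b + (s % L + (L ∸ s % L))) % L       ≡⟨ cong (λ x → (b + x) % L) (m+[n∸m]≡n (m%n≤n s L)) ⟩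
    (b + L) % L                           ≡⟨ [m+n]%n≡m%n b L ⟩
    b % L                                 ≡⟨ m<n⇒m%n≡m (s≤s b≤K) ⟩
    b                                     ∎
    where L = suc K

  rotate-injective : ∀ s {b b'} → b ≤ K → b' ≤ K → rotate s b ≡ rotate s b' → b ≡ b'
  rotate-injective s {b} {b'} b≤K b'≤K eq = begin
    b                           ≡⟨ rotate-back s b≤K ⟨
    rotate _ (rotate s b)       ≡⟨ cong (rotate _) eq ⟩
    rotate _ (rotate s b')      ≡⟨ rotate-back s b'≤K ⟩
    b'                          ∎

  rotate-injective′ : ∀ s {b b' x} → b ≤ K → b' ≤ K → rotate s b ≡ x → rotate s b' ≡ x → b ≡ b'
  rotate-injective′ s b≤K b'≤K e e' = rotate-injective s b≤K b'≤K (trans e (sym e'))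

  rotate-reflects-next : ∀ s {b b'} → b ≤ K → b' ≤ K → suc (rotate s b) ≡ rotate s b' → next b ≡ b'
  rotate-reflects-next s {b} {b'} b≤K b'≤K eq = rotate-injective s (next-≤ b) b'≤K (begin
    rotate s (next b)           ≡⟨ rotate-next s b ⟩
    suc (rotate s b) % suc K    ≡⟨ cong (_% suc K) eq ⟩
    rotate s b' % suc K         ≡⟨ m%n%n≡m%n (b' + s) (suc K) ⟩
    rotate s b'                 ∎)

  rotate-onto : ∀ {c} a → c ≤ K → a ≤ K → rotate (suc K ∸ c + a) c ≡ a
  rotate-onto {c} a c≤K a≤K = begin
    (c + (L ∸ c + a)) % L    ≡⟨ cong (_% L) (+-assoc c (L ∸ c) a) ⟨
    (c + (L ∸ c) + a) % L    ≡⟨ cong (λ x → (x + a) % L) (m+[n∸m]≡n (m≤n⇒m≤1+n c≤K)) ⟩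
    (L + a) % L              ≡⟨ cong (_% L) (+-comm L a) ⟩
    (a + L) % L              ≡⟨ [m+n]%n≡m%n a L ⟩
    a % L                    ≡⟨ m<n⇒m%n≡m (s≤s a≤K) ⟩
    a                        ∎
    where L = suc K

  RotatedWindow : ℕ → ℕ → ℕ → Set
  RotatedWindow s Q b = rotate s b ≤ Q × Q ≤ suc (rotate s b)

  window? : ∀ s Q b → Dec (RotatedWindow s Q b)
  window? s Q b = (rotate s b ≤? Q) ×-dec (Q ≤? suc (rotate s b))

  window-near : ∀ s Q {b b'} → b ≤ K → b' ≤ K →
                RotatedWindow s Q b → RotatedWindow s Q b' → Near b b'
  window-near s Q b≤K b'≤K (b≤Q , Q≤b) (b'≤Q , Q≤b')
    with window-values b≤Q Q≤b | window-values b'≤Q Q≤b'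
  ... | inj₁ e | inj₁ e' = inj₁ (rotate-injective′ s b≤K b'≤K e e')
  ... | inj₁ e | inj₂ e' = inj₂ (inj₂ (rotate-reflects-next s b'≤K b≤K (trans e' (sym e))))
  ... | inj₂ e | inj₁ e' = inj₂ (inj₁ (rotate-reflects-next s b≤K b'≤K (trans e (sym e'))))
  ... | inj₂ e | inj₂ e' = inj₁ (rotate-injective′ s b≤K b'≤K (cong pred e) (cong pred e'))

  window-at-most-two : ∀ s Q {b₁ b₂ b₃} → b₁ ≤ K → b₂ ≤ K → b₃ ≤ K →
                       RotatedWindow s Q b₁ → RotatedWindow s Q b₂ → RotatedWindow s Q b₃ →
                       b₁ ≡ b₂ ⊎ b₁ ≡ b₃ ⊎ b₂ ≡ b₃
  window-at-most-two s Q b₁≤K b₂≤K b₃≤K (p₁ , q₁) (p₂ , q₂) (p₃ , q₃)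
    with window-values p₁ q₁ | window-values p₂ q₂ | window-values p₃ q₃
  ... | inj₁ e₁ | inj₁ e₂ | _      = inj₁ (rotate-injective′ s b₁≤K b₂≤K e₁ e₂)
  ... | inj₂ e₁ | inj₂ e₂ | _      = inj₁ (rotate-injective′ s b₁≤K b₂≤K (cong pred e₁) (cong pred e₂))
  ... | inj₁ e₁ | inj₂ _  | inj₁ e₃ = inj₂ (inj₁ (rotate-injective′ s b₁≤K b₃≤K e₁ e₃))
  ... | inj₂ e₁ | inj₁ _  | inj₂ e₃ = inj₂ (inj₁ (rotate-injective′ s b₁≤K b₃≤K (cong pred e₁) (cong pred e₃)))
  ... | inj₁ _  | inj₂ e₂ | inj₂ e₃ = inj₂ (inj₂ (rotate-injective′ s b₂≤K b₃≤K (cong pred e₂) (cong pred e₃)))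
  ... | inj₂ _  | inj₁ e₂ | inj₁ e₃ = inj₂ (inj₂ (rotate-injective′ s b₂≤K b₃≤K e₂ e₃))

  next-flips-parity : ∀ c {a} b → suc c + 2 * a ≤ K → next (suc c + 2 * a) ≢ suc c + 2 * b
  next-flips-parity c {a} b a≤K eq with next-cases a≤K
  ... | inj₁ (_ , next≡suc) = even≢odd b a (sym (+-cancelˡ-≡ c _ _ (begin
    c + suc (2 * a)     ≡⟨ +-suc c (2 * a) ⟩
    suc (c + 2 * a)     ≡⟨ suc-injective (trans (sym next≡suc) eq) ⟩
    c + 2 * b           ∎)))
  ... | inj₂ (_ , next≡0) = 0≢1+n (trans (sym next≡0) eq)

  near-same-parity : ∀ c {a b} → suc c + 2 * a ≤ K → suc c + 2 * b ≤ K →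
                     Near (suc c + 2 * a) (suc c + 2 * b) → a ≡ b
  near-same-parity c {a} {b} _ _ (inj₁ eq) = *-cancelˡ-≡ a b 2 (+-cancelˡ-≡ (suc c) _ _ eq)
  near-same-parity c {a} {b} a≤K _ (inj₂ (inj₁ eq)) = ⊥-elim (next-flips-parity c {a} b a≤K eq)
  near-same-parity c {a} {b} _ b≤K (inj₂ (inj₂ eq)) = ⊥-elim (next-flips-parity c {b} a b≤K eq)

∷-injective : ∀ {n m} {a : Fin m} {f : Fin n → Fin m} →
              (∀ e → f e ≢ a) → Injective _≡_ _≡_ f → Injective _≡_ _≡_ (a ∷ f)
∷-injective a∉f f-inj {F.zero}  {F.zero}   eq = refl
∷-injective a∉f f-inj {F.zero}  {F.suc e}  eq = ⊥-elim (a∉f e (sym eq))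
∷-injective a∉f f-inj {F.suc e} {F.zero}   eq = ⊥-elim (a∉f e eq)
∷-injective a∉f f-inj {F.suc e} {F.suc e'} eq = cong F.suc (f-inj eq)

missing-unique : ∀ {n} {f : Fin n → Fin (suc n)} → Injective _≡_ _≡_ f →
                 ∀ {a b} → (∀ e → f e ≢ a) → (∀ e → f e ≢ b) → a ≡ b
missing-unique {f = f} f-inj {a} {b} a∉f b∉f with a FP.≟ b
... | yes a≡b = a≡b
... | no a≢b = ⊥-elim (FP.<⇒notInjective ≤-refl (∷-injective b∉a∷f (∷-injective a∉f f-inj)))
  where
  b∉a∷f : ∀ e → (a ∷ f) e ≢ b
  b∉a∷f F.zero = a≢b
  b∉a∷f (F.suc e) = b∉f e

module DecidableGraph {n} (R : Fin n → Fin n → Set) (R? : ∀ u w → Dec (R u w))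
  (R-sym : ∀ {u w} → R u w → R w u) (R-irrefl : ∀ {u} → ¬ R u u) where

  graph : Graph n
  graph = record
    { adj = λ u w → does (R? u w)
    ; adj-sym = λ u w → does-⇔ (mk⇔ R-sym R-sym) (R? u w) (R? w u)
    ; loopless = λ u → dec-false (R? u u) R-irrefl
    }

  Adj⇒ : ∀ {u w} → Adj graph u w → R u w
  Adj⇒ {u} {w} with R? u w
  ... | yes r = λ _ → r
  ... | no _ = λ ()

  ⇒Adj : ∀ {u w} → R u w → Adj graph u w
  ⇒Adj {u} {w} = dec-true (R? u w)

module CycleBlowUp (k' s : ℕ) where

  k m K N : ℕ
  k = suc k'
  m = suc (suc s)
  K = 2 * k
  N = k * m + 1

  open Cycle K

  Vertex : Set
  Vertex = (Fin k × Fin m) ⊎ ⊤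

  vertices : Fin N ↔ Vertex
  vertices = (FP.*↔× ⊎-↔ FP.1↔⊤) ↔-∘ FP.+↔⊎

  open Inverse vertices using (to; from; strictlyInverseˡ; strictlyInverseʳ)

  hub : Vertex
  hub = inj₂ tt

  block-≤ : ∀ (i : Fin k) → 2 + 2 * toℕ i ≤ K
  block-≤ i = subst (_≤ K) (*-suc 2 (toℕ i)) (*-monoʳ-≤ 2 (FP.toℕ<n i))

  bag : Vertex → ℕ
  bag (inj₁ (i , F.zero)) = 1 + 2 * toℕ i
  bag (inj₁ (i , F.suc _)) = 2 + 2 * toℕ i
  bag (inj₂ tt) = 0

  bag-≤ : ∀ v → bag v ≤ K
  bag-≤ (inj₁ (i , F.zero)) = ≤-trans (n≤1+n _) (block-≤ i)
  bag-≤ (inj₁ (i , F.suc _)) = block-≤ i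
  bag-≤ (inj₂ tt) = z≤n

  position : Fin N → ℕ
  position = bag ∘ to

  to-injective : ∀ {u w} → to u ≡ to w → u ≡ w
  to-injective {u} {w} eq = begin
    u             ≡⟨ strictlyInverseʳ u ⟨
    from (to u)   ≡⟨ cong from eq ⟩
    from (to w)   ≡⟨ strictlyInverseʳ w ⟩
    w             ∎

  Linked : Fin N → Fin N → Set
  Linked u w = Near (position u) (position w) × u ≢ w

  open DecidableGraph Linked (λ u w → near? _ _ ×-dec ¬? (u FP.≟ w))
    (λ (near , u≢w) → near-sym near , u≢w ∘ sym) (λ (_ , u≢u) → u≢u refl)

  G : Graph N
  G = graph

  linked : ∀ {a b} → Near (bag a) (bag b) → a ≢ b → Adj G (from a) (from b)
  linked {a} {b} near a≢b = ⇒Adj {from a} {from b}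
    ( subst₂ (λ x y → Near (bag x) (bag y)) (sym (strictlyInverseˡ a)) (sym (strictlyInverseˡ b)) near
    , λ eq → a≢b (trans (sym (strictlyInverseˡ a)) (trans (cong to eq) (strictlyInverseˡ b))) )

  apex-after-side : ∀ (j : Fin k') → next (2 + 2 * toℕ (inject₁ j)) ≡ 1 + 2 * toℕ (F.suc j)
  apex-after-side j = begin
    next (2 + 2 * toℕ (inject₁ j)) ≡⟨ cong (λ x → next (2 + 2 * x)) (FP.toℕ-inject₁ j) ⟩
    next (2 + 2 * toℕ j)           ≡⟨ next-< (≤-trans (n≤1+n _) next-block-≤) ⟩
    3 + 2 * toℕ j                  ≡⟨ cong suc (*-suc 2 (toℕ j)) ⟨
    1 + 2 * suc (toℕ j)            ∎
    where
    next-block-≤ : 4 + 2 * toℕ j ≤ K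
    next-block-≤ = subst (_≤ K) (cong (2 +_) (*-suc 2 (toℕ j))) (block-≤ (F.suc j))

  last-block : 2 + 2 * toℕ (fromℕ k') ≡ K
  last-block = begin
    2 + 2 * toℕ (fromℕ k') ≡⟨ cong (λ x → 2 + 2 * x) (FP.toℕ-fromℕ k') ⟩
    2 + 2 * k'             ≡⟨ *-suc 2 k' ⟨
    K                      ∎

  apex : Fin k → Vertex
  apex i = inj₁ (i , F.zero)

  side : Fin k → Fin (suc s) → Vertex
  side i e = inj₁ (i , F.suc e)

  not-colourable : ¬ Colourable G m
  not-colourable (f , proper) = clash hub (apex F.zero) hub~apex₀ (λ ()) (trans hub≈last apexes-agree)
    where
    colour : Vertex → Fin m
    colour = f ∘ from

    clash : ∀ a b → Near (bag a) (bag b) → a ≢ b → colour a ≢ colour b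
    clash a b near a≢b = proper (from a) (from b) (linked near a≢b)

    side-injective : ∀ i → Injective _≡_ _≡_ (colour ∘ side i)
    side-injective i {e} {e'} same with e FP.≟ e'
    ... | yes e≡e' = e≡e'
    ... | no e≢e' = ⊥-elim (clash (side i e) (side i e') (inj₁ refl) (λ { refl → e≢e' refl }) same)

    apex-missing : ∀ i e → colour (side i e) ≢ colour (apex i)
    apex-missing i e = clash (side i e) (apex i) (inj₂ (inj₂ (next-< (block-≤ i)))) (λ ())

    successor-missing : ∀ j e → colour (side (inject₁ j) e) ≢ colour (apex (F.suc j))
    successor-missing j e = clash (side (inject₁ j) e) (apex (F.suc j)) (inj₂ (inj₁ (apex-after-side j))) (λ ())

    last : Fin k
    last = fromℕ k'

    hub-missing : ∀ e → colour (side last e) ≢ colour hub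
    hub-missing e = clash (side last e) hub (inj₂ (inj₁ (trans (cong next last-block) next-last))) (λ ())

    hub~apex₀ : Near (bag hub) (bag (apex F.zero))
    hub~apex₀ = inj₂ (inj₁ (next-< (s≤s z≤n)))

    apexes-agree : colour (apex last) ≡ colour (apex F.zero)
    apexes-agree = <-weakInduction (λ i → colour (apex i) ≡ colour (apex F.zero)) refl
      (λ j ih → trans (missing-unique (side-injective (inject₁ j)) (successor-missing j) (apex-missing (inject₁ j))) ih)
      last

    hub≈last : colour hub ≡ colour (apex last)
    hub≈last = missing-unique (side-injective last) hub-missing (apex-missing last)

  module TwoNearBags (W : ℕ → Set) (W1? : Dec (W 1))
    (near : ∀ {b b'} → b ≤ K → b' ≤ K → W b → W b' → Near b b')
    (at-most-two : ∀ {b₁ b₂ b₃} → b₁ ≤ K → b₂ ≤ K → b₃ ≤ K → W b₁ → W b₂ → W b₃ →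
                   b₁ ≡ b₂ ⊎ b₁ ≡ b₃ ⊎ b₂ ≡ b₃) where

    -- The bags next to the hub's are apex₀'s (slot 0) and the last sides' (slots ≥ 1).
    hub-slot : Dec (W 1) → Fin m
    hub-slot (yes _) = F.suc F.zero
    hub-slot (no _) = F.zero

    slot : Vertex → Fin m
    slot (inj₁ (_ , j)) = j
    slot (inj₂ tt) = hub-slot W1?

    hub-slot-unused : ∀ {i j} (W1? : Dec (W 1)) → W 0 → W (bag (inj₁ (i , j))) → hub-slot W1? ≢ j
    hub-slot-unused {i} (yes w₁) w₀ wᵢ refl with at-most-two z≤n (s≤s z≤n) (block-≤ i) w₀ w₁ wᵢ
    ... | inj₁ ()
    ... | inj₂ (inj₁ ())
    ... | inj₂ (inj₂ ())
    hub-slot-unused {i} (no ¬w₁) w₀ wᵢ refl with near z≤n (bag-≤ (apex i)) w₀ wᵢ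
    ... | inj₁ ()
    ... | inj₂ (inj₁ next0≡) = ¬w₁ (subst W (sym (trans (sym (next-< (s≤s z≤n))) next0≡)) wᵢ)
    ... | inj₂ (inj₂ next≡0) with next-cases (bag-≤ (apex i))
    ...   | inj₁ (_ , next≡suc) = 0≢1+n (trans (sym next≡0) next≡suc)
    ...   | inj₂ (apex≡K , _) = even≢odd k (toℕ i) (sym apex≡K)

    slot-injective : ∀ a b → W (bag a) → W (bag b) → slot a ≡ slot b → a ≡ b
    slot-injective (inj₁ (i , F.zero)) (inj₁ (i' , .F.zero)) wa wb refl =
      cong apex (FP.toℕ-injective (near-same-parity 0 i≤K i'≤K (near i≤K i'≤K wa wb)))
      where
      i≤K = bag-≤ (apex i)
      i'≤K = bag-≤ (apex i')
    slot-injective (inj₁ (i , F.suc e)) (inj₁ (i' , .(F.suc e))) wa wb refl =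
      cong (λ i → side i e) (FP.toℕ-injective (near-same-parity 1 i≤K i'≤K (near i≤K i'≤K wa wb)))
      where
      i≤K = block-≤ i
      i'≤K = block-≤ i'
    slot-injective (inj₁ _) (inj₂ tt) wa w₀ eq = ⊥-elim (hub-slot-unused W1? w₀ wa (sym eq))
    slot-injective (inj₂ tt) (inj₁ _) w₀ wb eq = ⊥-elim (hub-slot-unused W1? w₀ wb eq)
    slot-injective (inj₂ tt) (inj₂ tt) _ _ _ = refl

  module BallLayering (r : ℕ) (r<k : r < k) (v : Fin N) where

    -- Rotating v's bag to the middle position k keeps the whole ball away from the seam K ↦ 0.
    shift : ℕ
    shift = suc K ∸ position v + k

    level : Fin N → ℕ
    level u = rotate shift (position u)

    Central : ℕ → Fin N → Set
    Central a u = k ≤ level u + a × level u ≤ k + a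

    central-v : Central 0 v
    central-v rewrite rotate-onto k (bag-≤ (to v)) (m≤m+n k (k + 0)) = m≤m+n k 0 , m≤m+n k 0

    central-mono : ∀ {a b u} → a ≤ b → Central a u → Central b u
    central-mono {u = u} a≤b (k≤ , ≤k+a) =
      ≤-trans k≤ (+-monoʳ-≤ (level u) a≤b) , ≤-trans ≤k+a (+-monoʳ-≤ k a≤b)

    central-interior : ∀ {a u} → a < k → Central a u → 0 < level u × level u < K
    central-interior {a} {u} a<k (k≤ , ≤k+a) =
      +-cancelʳ-< a 0 (level u) (<-≤-trans a<k k≤) ,
      ≤-<-trans ≤k+a (<-≤-trans (+-monoʳ-< k a<k) (≤-reflexive (cong (k +_) (sym (+-identityʳ k)))))

    adjacent-levels : ∀ x y → 0 < level x → level x < K → Adj G x y →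
                      level y ≤ suc (level x) × level x ≤ suc (level y)
    adjacent-levels x y 0<x x<K x~y =
      near-interior (rotate-near shift (proj₁ (Adj⇒ {x} {y} x~y))) 0<x x<K (rotate-≤ shift (position y))

    central-step : ∀ {a x y} → Central a x → level y ≤ suc (level x) × level x ≤ suc (level y) →
                   Central (suc a) y
    central-step {a} {x} {y} (k≤ , ≤k+a) (y≤ , x≤) =
      ≤-trans k≤ (≤-trans (+-monoˡ-≤ a x≤) (≤-reflexive (sym (+-suc (level y) a)))) ,
      ≤-trans y≤ (≤-trans (s≤s ≤k+a) (≤-reflexive (sym (+-suc k a))))

    walk-central : ∀ {a n x u} → Central a x → WithinDist G n x u → a + n < k → Central (a + n) u
    walk-central {a} {n} {u = u} central here _ = central-mono {u = u} (m≤m+n a n) central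
    walk-central {a} {suc n} {x} {u} central (step {x = y} x~y rest) a+n<k =
      subst (λ b → Central b u) (sym (+-suc a n))
        (walk-central (central-step {x = x} {y} central (adjacent-levels x y 0<x x<K x~y)) rest
          (subst (_< k) (+-suc a n) a+n<k))
      where
      a<k : a < k
      a<k = ≤-<-trans (m≤m+n a (suc n)) a+n<k
      0<x : 0 < level x
      0<x = proj₁ (central-interior {u = x} a<k central)
      x<K : level x < K
      x<K = proj₂ (central-interior {u = x} a<k central)

    ball-central : ∀ {u} → Ball G r v u → Central r u
    ball-central v~u = walk-central central-v v~u r<k

    level-step : ∀ u w → Ball G r v u → Ball G r v w → Adj G u w → level w ≤ suc (level u)
    level-step u w v~u _ u~w = let 0<u , u<K = central-interior {u = u} r<k (ball-central v~u) in
      proj₁ (adjacent-levels u w 0<u u<K u~w)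

    open Layering G (Ball G r v) level level-step

    narrow-windows : NarrowWindows m
    narrow-windows Q = slot ∘ to ,
      λ u w _ _ u∈Q w∈Q same → to-injective (slot-injective (to u) (to w) u∈Q w∈Q same)
      where
      open TwoNearBags (RotatedWindow shift Q) (window? shift Q 1)
        (window-near shift Q) (window-at-most-two shift Q)

    ball-minor-free : ¬ KMinorModel G (Ball G r v) (suc m)
    ball-minor-free = no-complete-minor narrow-windows

  locally-minor-free : ∀ r → r < k → LocallyKMinorFree G r (suc m)
  locally-minor-free r r<k v = BallLayering.ball-minor-free r r<k v

mainTheorem3 : (t k : ℕ) → 3 ≤ t → 1 ≤ k →
    Σ (Graph (k * (t ∸ 1) + 1)) λ G →
      LocallyKMinorFree G (k / 2) t × ¬ Colourable G (t ∸ 1)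
mainTheorem3 (suc (suc (suc s))) (suc k') _ _ =
  G , locally-minor-free (suc k' / 2) (m/n<m (suc k') 2 (s≤s (s≤s z≤n))) , not-colourable
  where open CycleBlowUp k' s
mainTheorem3 (suc (suc (suc s))) zero _ ()
mainTheorem3 (suc (suc zero)) _ (s≤s (s≤s ())) _
mainTheorem3 (suc zero) _ (s≤s ()) _
mainTheorem3 zero _ () _
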